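{- Let $a,b,m,n$ be nonnegative integers. Then $$(0^m,a)\ast(0^n,b)=\sum_{i=0}^{m}\sum_{k=n}^{m+n-i}\binom{k}{n}\binom{n+1}{i+k-m+1}(0^k,b,0^i,a)+\sum_{i=0}^{n}\sum_{k=m}^{m+n-i}\binom{k}{m}\binom{m+1}{i+k-n+1}(0^k,a,0^i,b)+\sum_{k=n}^{m+n}\binom{k}{n}\binom{n}{k-m}(0^k,a+b).$$
   Context: $0^i$ denotes a sequence of $i$ zeros; sequences are concatenated. Binomial convention: $\binom{p}{q}=0$ if $p<q$ or $q<0$. The quasi-shuffle product $\ast$ is the bilinear product on the free module spanned by finite sequences of nonnegative integers defined by $()\ast\alpha=\alpha\ast()=\alpha$ and, for $\alpha=(\alpha_1,\ldots,\alpha_p)$, $\beta=(\beta_1,\ldots,\beta_q)$ with $p,q\geq1$, $\alpha\ast\beta=(\alpha_1,(\alpha_2,\ldots,\alpha_p)\ast\beta)+(\beta_1,\alpha\ast(\beta_2,\ldots,\beta_q))+(\alpha_1+\beta_1,(\alpha_2,\ldots,\alpha_p)\ast(\beta_2,\ldots,\beta_q))$, where prepending an entry is extended linearly. -}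

module Defs where

open import Data.Nat using (ℕ; zero; suc; _+_; _*_; _∸_; _≟_)
open import Data.Nat.Combinatorics using (_C_)
open import Data.Integer using (ℤ; +_; -[1+_])
open import Data.Product using (_×_; _,_)
open import Data.List using (List; []; _∷_; [_]; map; _++_; replicate; upTo; concatMap)
import Data.List.Properties as LP
open import Relation.Nullary using (yes; no)
open import Relation.Binary.PropositionalEquality using (_≡_)

Word : Set
Word = List ℕ

zeros : ℕ → Word
zeros k = replicate k 0

-- Elements of the free module spanned by words, as formal linear
-- combinations (list of coefficient/word pairs).  All coefficients in the
-- statement are nonnegative, so ℕ-coefficients suffice (ℕ ↪ ℤ).
LinComb : Set
LinComb = List (ℕ × Word)

coeff : LinComb → Word → ℕ
coeff [] w = 0
coeff ((c , v) ∷ l) w with LP.≡-dec _≟_ v w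
... | yes _ = c + coeff l w
... | no  _ = coeff l w

_≈ₗ_ : LinComb → LinComb → Set
x ≈ₗ y = ∀ w → coeff x w ≡ coeff y w

prepend : ℕ → LinComb → LinComb
prepend a = map (λ { (c , v) → (c , a ∷ v) })

infixl 7 _⋆_
_⋆_ : Word → Word → LinComb
[] ⋆ β = [ (1 , β) ]
(a ∷ α) ⋆ [] = [ (1 , a ∷ α) ]
(a ∷ α) ⋆ (b ∷ β) =
  prepend a (α ⋆ (b ∷ β)) ++ prepend b ((a ∷ α) ⋆ β) ++ prepend (a + b) (α ⋆ β)

-- Binomial coefficient with integer lower index: binom p q = 0 if q < 0
-- (and p C q = 0 if p < q already in the standard library).
binom : ℕ → ℤ → ℕ
binom p (+ q) = p C q
binom p -[1+ _ ] = 0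

range : ℕ → ℕ → List ℕ
range lo hi = map (λ j → lo + j) (upTo (suc hi ∸ lo))

Σ[_to_] : ℕ → ℕ → (ℕ → LinComb) → LinComb
Σ[ lo to hi ] f = concatMap f (range lo hi)

_·_ : ℕ → Word → LinComb
c · w = [ (c , w) ]

-- Write L m n for (0^m a) ⋆ (0^n b) and 0·X for X with 0 prepended to every word. Unfolding ⋆,
-- L (m+1) (n+1) = 0·(L m (n+1) + L (m+1) n + L m n), while L 0 (n+1) and L (m+1) 0 are 0·L 0 n and
-- 0·L m 0 plus two words without a leading zero. The closed form obeys the same recursions in the
-- number k of leading zeros: in the bulk this is Pascal's rule in both binomials, and on the boundary
-- a product C(k+1,n+1) C(p+1,j+1) collapses to C(k,n) C(p,j) because the three cross terms of its
-- Pascal expansion vanish. Both sides are compared coefficient by coefficient at an arbitrary word w,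
-- since for a = 0 or b = 0 distinct terms of the closed form can be the same word, and every sum is
-- extended to a fixed square box outside of which the closed-form coefficients vanish.
module Submission where

open import Defs
open import Data.Nat using (ℕ; zero; suc; _+_; _∸_; _*_; _≤_; _<_; z≤n; s≤s; _≟_)
open import Data.Nat.Properties
open import Data.Nat.Combinatorics using (_C_; nCk+nC[k+1]≡[n+1]C[k+1]; k>n⇒nCk≡0)
open import Data.Nat.Solver using (module +-*-Solver)
open import Data.List using ([]; _∷_; [_]; _++_; map; drop; concatMap; applyUpTo)
import Data.List.Properties as List
open import Data.Product using (_,_)
open import Function using (_∘_)
open import Relation.Binary.PropositionalEquality hiding ([_])
open import Relation.Nullary using (Dec; yes; no; ¬_; contradiction)
open import Algebra.Properties.CommutativeSemigroup +-commutativeSemigroup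
  using () renaming (interchange to +-interchange)
open import Algebra.Properties.CommutativeSemigroup *-commutativeSemigroup
  using () renaming (x∙yz≈y∙xz to x*[y*z]≡y*[x*z])
open +-*-Solver using (solve; _:+_; _:*_; _:=_)

∑< : ℕ → (ℕ → ℕ) → ℕ
∑< zero    f = 0
∑< (suc N) f = f 0 + ∑< N (f ∘ suc)

∑<-cong-< : ∀ N {f g : ℕ → ℕ} → (∀ j → j < N → f j ≡ g j) → ∑< N f ≡ ∑< N g
∑<-cong-< zero    eq = refl
∑<-cong-< (suc N) eq = cong₂ _+_ (eq 0 (s≤s z≤n)) (∑<-cong-< N (λ j j<N → eq (suc j) (s≤s j<N)))

∑<-cong : ∀ N {f g : ℕ → ℕ} → (∀ j → f j ≡ g j) → ∑< N f ≡ ∑< N g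
∑<-cong N eq = ∑<-cong-< N (λ j _ → eq j)

∑<-vanish : ∀ N {f : ℕ → ℕ} → (∀ j → j < N → f j ≡ 0) → ∑< N f ≡ 0
∑<-vanish zero    eq = refl
∑<-vanish (suc N) eq = cong₂ _+_ (eq 0 (s≤s z≤n)) (∑<-vanish N (λ j j<N → eq (suc j) (s≤s j<N)))

∑<-distrib-+ : ∀ N (f g : ℕ → ℕ) → ∑< N (λ j → f j + g j) ≡ ∑< N f + ∑< N g
∑<-distrib-+ zero    f g = refl
∑<-distrib-+ (suc N) f g =
  trans (cong (f 0 + g 0 +_) (∑<-distrib-+ N (f ∘ suc) (g ∘ suc))) (+-interchange (f 0) (g 0) _ _)

*-distribˡ-∑< : ∀ N c (f : ℕ → ℕ) → c * ∑< N f ≡ ∑< N (λ j → c * f j)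
*-distribˡ-∑< zero    c f = *-zeroʳ c
*-distribˡ-∑< (suc N) c f = trans (*-distribˡ-+ c (f 0) _) (cong (c * f 0 +_) (*-distribˡ-∑< N c (f ∘ suc)))

∑<-split : ∀ M N (f : ℕ → ℕ) → ∑< (M + N) f ≡ ∑< M f + ∑< N (λ j → f (M + j))
∑<-split zero    N f = refl
∑<-split (suc M) N f = trans (cong (f 0 +_) (∑<-split M N (f ∘ suc))) (sym (+-assoc (f 0) _ _))

∑<-window : ∀ lo M K (f : ℕ → ℕ) → (∀ k → k < lo → f k ≡ 0) → (∀ k → lo + M ≤ k → f k ≡ 0) →
            lo + M ≤ K → ∑< M (λ j → f (lo + j)) ≡ ∑< K f
∑<-window lo M K f below above lo+M≤K = begin
  ∑< M (λ j → f (lo + j))                      ≡⟨ cong (_+ ∑< M (λ j → f (lo + j))) (∑<-vanish lo below) ⟨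
  ∑< lo f + ∑< M (λ j → f (lo + j))            ≡⟨ ∑<-split lo M f ⟨
  ∑< (lo + M) f                                ≡⟨ +-identityʳ _ ⟨
  ∑< (lo + M) f + 0
    ≡⟨ cong (∑< (lo + M) f +_) (∑<-vanish R (λ j _ → above (lo + M + j) (m≤m+n _ j))) ⟨
  ∑< (lo + M) f + ∑< R (λ j → f (lo + M + j))  ≡⟨ ∑<-split (lo + M) R f ⟨
  ∑< (lo + M + R) f                            ≡⟨ cong (λ L → ∑< L f) (m+[n∸m]≡n lo+M≤K) ⟩
  ∑< K f                                       ∎
  where
  open ≡-Reasoning
  R = K ∸ (lo + M)

∑<-triangle : ∀ X Y S (f : ℕ → ℕ → ℕ) → X + Y ≡ S →
              (∀ i k → k < Y → f i k ≡ 0) → (∀ i k → S < i + k → f i k ≡ 0) →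
              ∑< (suc X) (λ i → ∑< (suc (S ∸ i) ∸ Y) (λ j → f i (Y + j))) ≡
              ∑< (suc S) (λ i → ∑< (suc S) (f i))
∑<-triangle X Y S f X+Y≡S left above =
  trans (∑<-cong-< (suc X) row) (∑<-window 0 (suc X) (suc S) _ (λ _ ()) lowerRows (s≤s X≤S))
  where
  X≤S : X ≤ S
  X≤S = subst (X ≤_) X+Y≡S (m≤m+n X Y)
  row : ∀ i → i < suc X → ∑< (suc (S ∸ i) ∸ Y) (λ j → f i (Y + j)) ≡ ∑< (suc S) (f i)
  row i (s≤s i≤X) = ∑<-window Y _ (suc S) (f i) (left i) right (subst (_≤ suc S) (sym Y+R≡) (s≤s (m∸n≤m S i)))
    where
    Y≤S∸i : Y ≤ S ∸ i
    Y≤S∸i = subst (_≤ S ∸ i) (trans (cong (_∸ X) (sym X+Y≡S)) (m+n∸m≡n X Y)) (∸-monoʳ-≤ S i≤X)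
    Y+R≡ : Y + (suc (S ∸ i) ∸ Y) ≡ suc (S ∸ i)
    Y+R≡ = m+[n∸m]≡n (≤-trans Y≤S∸i (n≤1+n _))
    right : ∀ k → Y + (suc (S ∸ i) ∸ Y) ≤ k → f i k ≡ 0
    right k le = above i k (begin-strict
      S             ≡⟨ m∸n+n≡m (≤-trans i≤X X≤S) ⟨
      S ∸ i + i     <⟨ +-monoˡ-< i (subst (_≤ k) Y+R≡ le) ⟩
      k + i         ≡⟨ +-comm k i ⟩
      i + k         ∎)
      where open ≤-Reasoning
  lowerRows : ∀ i → suc X ≤ i → ∑< (suc S) (f i) ≡ 0
  lowerRows i X<i = ∑<-vanish (suc S) vanish
    where
    vanish : ∀ k → k < suc S → f i k ≡ 0
    vanish k _ with k <? Y
    ... | yes k<Y = left i k k<Y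
    ... | no  k≮Y = above i k (subst (λ t → suc t ≤ i + k) X+Y≡S (+-mono-≤ X<i (≮⇒≥ k≮Y)))

infix 8 _C[_⊖_]

-- p C[ u ⊖ v ] is the binomial coefficient p choose (u - v), read as 0 when u < v.
_C[_⊖_] : ℕ → ℕ → ℕ → ℕ
p C[ u     ⊖ zero  ] = p C u
p C[ zero  ⊖ suc v ] = 0
p C[ suc u ⊖ suc v ] = p C[ u ⊖ v ]

p+v<u⇒pC[u⊖v]≡0 : ∀ p u v → p + v < u → p C[ u ⊖ v ] ≡ 0
p+v<u⇒pC[u⊖v]≡0 p u       zero    p+0<u = k>n⇒nCk≡0 (subst (_< u) (+-identityʳ p) p+0<u)
p+v<u⇒pC[u⊖v]≡0 p zero    (suc v) _     = refl
p+v<u⇒pC[u⊖v]≡0 p (suc u) (suc v) p+v<u = p+v<u⇒pC[u⊖v]≡0 p u v (≤-pred (subst (_< suc u) (+-suc p v) p+v<u))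

[1+p]C[u⊖v]≡pC[u⊖1+v]+pC[u⊖v] : ∀ p u v → suc p C[ u ⊖ v ] ≡ p C[ u ⊖ suc v ] + p C[ u ⊖ v ]
[1+p]C[u⊖v]≡pC[u⊖1+v]+pC[u⊖v] p zero    zero    = refl
[1+p]C[u⊖v]≡pC[u⊖1+v]+pC[u⊖v] p zero    (suc v) = refl
[1+p]C[u⊖v]≡pC[u⊖1+v]+pC[u⊖v] p (suc u) zero    = sym (nCk+nC[k+1]≡[n+1]C[k+1] p u)
[1+p]C[u⊖v]≡pC[u⊖1+v]+pC[u⊖v] p (suc u) (suc v) = [1+p]C[u⊖v]≡pC[u⊖1+v]+pC[u⊖v] p u v

k<n⇒kCn*x≡0 : ∀ {k n} x → k < n → (k C n) * x ≡ 0
k<n⇒kCn*x≡0 x k<n = cong (_* x) (k>n⇒nCk≡0 k<n)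

p+k<q+n⇒kCn*pCq≡0 : ∀ k n p q → p + k < q + n → (k C n) * (p C q) ≡ 0
p+k<q+n⇒kCn*pCq≡0 k n p q p+k<q+n with k <? n
... | yes k<n = k<n⇒kCn*x≡0 (p C q) k<n
... | no  k≮n = trans (cong ((k C n) *_) (k>n⇒nCk≡0 p<q)) (*-zeroʳ (k C n))
  where
  p<q : p < q
  p<q = +-cancelʳ-< n p q (≤-<-trans (+-monoʳ-≤ p (≮⇒≥ k≮n)) p+k<q+n)

p+v<u⇒x*pC[u⊖v]≡0 : ∀ x p u v → p + v < u → x * p C[ u ⊖ v ] ≡ 0
p+v<u⇒x*pC[u⊖v]≡0 x p u v p+v<u = trans (cong (x *_) (p+v<u⇒pC[u⊖v]≡0 p u v p+v<u)) (*-zeroʳ x)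

[1+k]C[1+n]*[1+p]C[1+j]≡kCn*pCj : ∀ k n p j → p + k ≤ j + n →
                                  (suc k C suc n) * (suc p C suc j) ≡ (k C n) * (p C j)
[1+k]C[1+n]*[1+p]C[1+j]≡kCn*pCj k n p j p+k≤j+n = begin
  (suc k C suc n) * (suc p C suc j)                     ≡⟨ sym (cong₂ _*_ (nCk+nC[k+1]≡[n+1]C[k+1] k n) (nCk+nC[k+1]≡[n+1]C[k+1] p j)) ⟩
  (A + B) * (P + Q)                                     ≡⟨ expand A B P Q ⟩
  A * P + A * Q + B * P + B * Q                         ≡⟨ cong₂ _+_ (cong₂ _+_ (cong (A * P +_) AQ≡0) BP≡0) BQ≡0 ⟩
  A * P + 0 + 0 + 0                                     ≡⟨ trans (+-identityʳ _) (trans (+-identityʳ _) (+-identityʳ _)) ⟩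
  A * P                                                 ∎
  where
  open ≡-Reasoning
  A = k C n ; B = k C suc n ; P = p C j ; Q = p C suc j
  expand : ∀ a b c d → (a + b) * (c + d) ≡ a * c + a * d + b * c + b * d
  expand = solve 4 (λ a b c d → (a :+ b) :* (c :+ d) := a :* c :+ a :* d :+ b :* c :+ b :* d) refl
  j+1+n≡j+[1+n] : suc j + n ≡ j + suc n
  j+1+n≡j+[1+n] = sym (+-suc j n)
  AQ≡0 : A * Q ≡ 0
  AQ≡0 = p+k<q+n⇒kCn*pCq≡0 k n p (suc j) (s≤s p+k≤j+n)
  BP≡0 : B * P ≡ 0
  BP≡0 = p+k<q+n⇒kCn*pCq≡0 k (suc n) p j (subst (suc (p + k) ≤_) j+1+n≡j+[1+n] (s≤s p+k≤j+n))
  BQ≡0 : B * Q ≡ 0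
  BQ≡0 = p+k<q+n⇒kCn*pCq≡0 k (suc n) p (suc j) (≤-trans (s≤s p+k≤j+n) (s≤s (+-monoʳ-≤ j (n≤1+n n))))

∑<-pick-two : ∀ n I (h : ℕ → ℕ) → 2 + n ≤ I → ∑< I (λ i → 1 C[ i ⊖ n ] * h i) ≡ h n + h (suc n)
∑<-pick-two zero    (suc (suc I)) h _ = cong₂ _+_ (*-identityˡ (h 0))
  (trans (cong₂ _+_ (*-identityˡ (h 1)) (∑<-vanish I (λ _ _ → refl))) (+-identityʳ (h 1)))
∑<-pick-two zero    (suc zero)    h (s≤s ())
∑<-pick-two (suc n) (suc I)       h (s≤s 2+n≤I) = ∑<-pick-two n I (h ∘ suc) 2+n≤I

∑<-pick-first : ∀ I (h : ℕ → ℕ) → 1 ≤ I → ∑< I (λ i → (1 C suc i) * h i) ≡ h 0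
∑<-pick-first (suc I) h _ = trans (cong₂ _+_ (*-identityˡ (h 0)) (∑<-vanish I (λ _ _ → refl))) (+-identityʳ (h 0))

δ : Word → Word → ℕ
δ v w with List.≡-dec _≟_ v w
... | yes _ = 1
... | no  _ = 0

δ-refl : ∀ v → δ v v ≡ 1
δ-refl v with List.≡-dec _≟_ v v
... | yes _   = refl
... | no  v≢v = contradiction refl v≢v

δ-≢ : ∀ {v w} → ¬ v ≡ w → δ v w ≡ 0
δ-≢ {v} {w} v≢w with List.≡-dec _≟_ v w
... | yes v≡w = contradiction v≡w v≢w
... | no  _   = refl

headδ : ℕ → Word → ℕ
headδ x []      = 0
headδ x (y ∷ _) = δ [ x ] [ y ]

δ-∷ : ∀ x v w → δ (x ∷ v) w ≡ headδ x w * δ v (drop 1 w)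
δ-∷ x v []      = refl
δ-∷ x v (y ∷ w) = by-cases (x ≟ y) (List.≡-dec _≟_ v w)
  where
  by-cases : Dec (x ≡ y) → Dec (v ≡ w) → δ (x ∷ v) (y ∷ w) ≡ δ [ x ] [ y ] * δ v w
  by-cases (no x≢y)   _          = trans (δ-≢ (x≢y ∘ List.∷-injectiveˡ))
                                         (cong (_* δ v w) (sym (δ-≢ (x≢y ∘ List.∷-injectiveˡ))))
  by-cases (yes refl) (yes refl) = trans (δ-refl (x ∷ v)) (sym (cong₂ _*_ (δ-refl [ x ]) (δ-refl v)))
  by-cases (yes refl) (no v≢w)   = trans (δ-≢ (v≢w ∘ List.∷-injectiveʳ))
                                         (sym (trans (cong (δ [ x ] [ x ] *_) (δ-≢ v≢w)) (*-zeroʳ (δ [ x ] [ x ]))))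

coeff-∷ : ∀ c v l w → coeff ((c , v) ∷ l) w ≡ c * δ v w + coeff l w
coeff-∷ c v l w with List.≡-dec _≟_ v w
... | yes _ = cong (_+ coeff l w) (sym (*-identityʳ c))
... | no  _ = cong (_+ coeff l w) (sym (*-zeroʳ c))

coeff-· : ∀ c v w → coeff (c · v) w ≡ c * δ v w
coeff-· c v w = trans (coeff-∷ c v [] w) (+-identityʳ _)

coeff-1· : ∀ v w → coeff (1 · v) w ≡ δ v w
coeff-1· v w = trans (coeff-· 1 v w) (*-identityˡ (δ v w))

coeff-++ : ∀ l l′ w → coeff (l ++ l′) w ≡ coeff l w + coeff l′ w
coeff-++ []            l′ w = refl
coeff-++ ((c , v) ∷ l) l′ w = begin
  coeff ((c , v) ∷ l ++ l′) w              ≡⟨ coeff-∷ c v (l ++ l′) w ⟩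
  c * δ v w + coeff (l ++ l′) w            ≡⟨ cong (c * δ v w +_) (coeff-++ l l′ w) ⟩
  c * δ v w + (coeff l w + coeff l′ w)     ≡⟨ +-assoc (c * δ v w) _ _ ⟨
  c * δ v w + coeff l w + coeff l′ w       ≡⟨ cong (_+ coeff l′ w) (coeff-∷ c v l w) ⟨
  coeff ((c , v) ∷ l) w + coeff l′ w       ∎
  where open ≡-Reasoning

coeff-++³ : ∀ l₁ l₂ l₃ w {x₁ x₂ x₃} → coeff l₁ w ≡ x₁ → coeff l₂ w ≡ x₂ → coeff l₃ w ≡ x₃ →
            coeff (l₁ ++ l₂ ++ l₃) w ≡ x₁ + x₂ + x₃
coeff-++³ l₁ l₂ l₃ w {x₁} eq₁ eq₂ eq₃ =
  trans (coeff-++ l₁ (l₂ ++ l₃) w)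
        (trans (cong₂ _+_ eq₁ (trans (coeff-++ l₂ l₃ w) (cong₂ _+_ eq₂ eq₃))) (sym (+-assoc x₁ _ _)))

coeff-prepend : ∀ x l w → coeff (prepend x l) w ≡ headδ x w * coeff l (drop 1 w)
coeff-prepend x []            w = sym (*-zeroʳ (headδ x w))
coeff-prepend x ((c , v) ∷ l) w = begin
  coeff (prepend x ((c , v) ∷ l)) w                  ≡⟨ coeff-∷ c (x ∷ v) (prepend x l) w ⟩
  c * δ (x ∷ v) w + coeff (prepend x l) w            ≡⟨ cong₂ (λ d e → c * d + e) (δ-∷ x v w) (coeff-prepend x l w) ⟩
  c * (h * δ v w′) + h * coeff l w′                  ≡⟨ cong (_+ h * coeff l w′) (x*[y*z]≡y*[x*z] c h _) ⟩
  h * (c * δ v w′) + h * coeff l w′                  ≡⟨ *-distribˡ-+ h _ _ ⟨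
  h * (c * δ v w′ + coeff l w′)                      ≡⟨ cong (h *_) (coeff-∷ c v l w′) ⟨
  h * coeff ((c , v) ∷ l) w′                         ∎
  where
  open ≡-Reasoning
  h = headδ x w
  w′ = drop 1 w

coeff-Σ-upTo : ∀ N (g h : ℕ → ℕ) (f : ℕ → LinComb) w →
               coeff (concatMap f (map g (applyUpTo h N))) w ≡ ∑< N (λ j → coeff (f (g (h j))) w)
coeff-Σ-upTo zero    g h f w = refl
coeff-Σ-upTo (suc N) g h f w =
  trans (coeff-++ (f (g (h 0))) _ w) (cong (coeff (f (g (h 0))) w +_) (coeff-Σ-upTo N g (h ∘ suc) f w))

coeff-Σ : ∀ lo hi (f : ℕ → LinComb) w → coeff (Σ[ lo to hi ] f) w ≡ ∑< (suc hi ∸ lo) (λ j → coeff (f (lo + j)) w)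
coeff-Σ lo hi f w = coeff-Σ-upTo (suc hi ∸ lo) (lo +_) (λ j → j) f w

⋆-identityʳ : ∀ α → α ⋆ [] ≡ 1 · α
⋆-identityʳ []      = refl
⋆-identityʳ (x ∷ α) = refl

coeff-Σ-· : ∀ lo hi (c : ℕ → ℕ) (W : ℕ → Word) w →
            coeff (Σ[ lo to hi ] (λ k → c k · W k)) w ≡ ∑< (suc hi ∸ lo) (λ j → c (lo + j) * δ (W (lo + j)) w)
coeff-Σ-· lo hi c W w = trans (coeff-Σ lo hi (λ k → c k · W k) w) (∑<-cong (suc hi ∸ lo) (λ j → coeff-· (c (lo + j)) (W (lo + j)) w))

coeff-Σ-triangle : ∀ X Y S (c c′ : ℕ → ℕ → ℕ) (W : ℕ → ℕ → Word) w → X + Y ≡ S → (∀ i k → c i k ≡ c′ i k) →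
                   (∀ i k → k < Y → c′ i k ≡ 0) → (∀ i k → S < i + k → c′ i k ≡ 0) →
                   coeff (Σ[ 0 to X ] (λ i → Σ[ Y to S ∸ i ] (λ k → c i k · W i k))) w ≡
                   ∑< (suc S) (λ i → ∑< (suc S) (λ k → c′ i k * δ (W i k) w))
coeff-Σ-triangle X Y S c c′ W w X+Y≡S c≡c′ below above = begin
  coeff (Σ[ 0 to X ] (λ i → Σ[ Y to S ∸ i ] (λ k → c i k · W i k))) w
    ≡⟨ coeff-Σ 0 X (λ i → Σ[ Y to S ∸ i ] (λ k → c i k · W i k)) w ⟩
  ∑< (suc X) (λ i → coeff (Σ[ Y to S ∸ i ] (λ k → c i k · W i k)) w)
    ≡⟨ ∑<-cong (suc X) (λ i → trans (coeff-Σ-· Y (S ∸ i) (c i) (W i) w)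
                                     (∑<-cong (suc (S ∸ i) ∸ Y) (λ j → cong (_* δ (W i (Y + j)) w) (c≡c′ i (Y + j))))) ⟩
  ∑< (suc X) (λ i → ∑< (suc (S ∸ i) ∸ Y) (λ j → c′ i (Y + j) * δ (W i (Y + j)) w))
    ≡⟨ ∑<-triangle X Y S (λ i k → c′ i k * δ (W i k) w) X+Y≡S
         (λ i k k<Y → cong (_* δ (W i k) w) (below i k k<Y)) (λ i k S<i+k → cong (_* δ (W i k) w) (above i k S<i+k)) ⟩
  ∑< (suc S) (λ i → ∑< (suc S) (λ k → c′ i k * δ (W i k) w))
    ∎
  where open ≡-Reasoning

coeff-Σ-window : ∀ lo hi (c c′ : ℕ → ℕ) (W : ℕ → Word) w → lo ≤ suc hi → (∀ k → c k ≡ c′ k) →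
                 (∀ k → k < lo → c′ k ≡ 0) → (∀ k → hi < k → c′ k ≡ 0) →
                 coeff (Σ[ lo to hi ] (λ k → c k · W k)) w ≡ ∑< (suc hi) (λ k → c′ k * δ (W k) w)
coeff-Σ-window lo hi c c′ W w lo≤1+hi c≡c′ below above = begin
  coeff (Σ[ lo to hi ] (λ k → c k · W k)) w
    ≡⟨ coeff-Σ-· lo hi c W w ⟩
  ∑< (suc hi ∸ lo) (λ j → c (lo + j) * δ (W (lo + j)) w)
    ≡⟨ ∑<-cong (suc hi ∸ lo) (λ j → cong (_* δ (W (lo + j)) w) (c≡c′ (lo + j))) ⟩
  ∑< (suc hi ∸ lo) (λ j → c′ (lo + j) * δ (W (lo + j)) w)
    ≡⟨ ∑<-window lo (suc hi ∸ lo) (suc hi) (λ k → c′ k * δ (W k) w) (λ k k<lo → cong (_* δ (W k) w) (below k k<lo))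
         (λ k le → cong (_* δ (W k) w) (above k (subst (_≤ k) lo+M≡1+hi le))) (≤-reflexive lo+M≡1+hi) ⟩
  ∑< (suc hi) (λ k → c′ k * δ (W k) w)
    ∎
  where
  open ≡-Reasoning
  lo+M≡1+hi : lo + (suc hi ∸ lo) ≡ suc hi
  lo+M≡1+hi = m+[n∸m]≡n lo≤1+hi

-- ba i, ab i and merged index the words 0^k b 0^i a, 0^k a 0^i b and 0^k (a+b) of the closed form.
data Slot : Set where
  ba ab  : ℕ → Slot
  merged : Slot

∑slot : ℕ → (Slot → ℕ) → ℕ
∑slot I g = ∑< I (g ∘ ba) + ∑< I (g ∘ ab) + g merged

∑slot-cong : ∀ I {g g′ : Slot → ℕ} → (∀ s → g s ≡ g′ s) → ∑slot I g ≡ ∑slot I g′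
∑slot-cong I eq = cong₂ _+_ (cong₂ _+_ (∑<-cong I (eq ∘ ba)) (∑<-cong I (eq ∘ ab))) (eq merged)

∑slot-vanish : ∀ I {g : Slot → ℕ} → (∀ s → g s ≡ 0) → ∑slot I g ≡ 0
∑slot-vanish I eq = trans (∑slot-cong I eq) (cong₂ _+_ (cong₂ _+_ (∑<-vanish I λ _ _ → refl) (∑<-vanish I λ _ _ → refl)) refl)

∑slot-distrib-+ : ∀ I (g g′ : Slot → ℕ) → ∑slot I (λ s → g s + g′ s) ≡ ∑slot I g + ∑slot I g′
∑slot-distrib-+ I g g′ = trans
  (cong₂ _+_ (cong₂ _+_ (∑<-distrib-+ I (g ∘ ba) (g′ ∘ ba)) (∑<-distrib-+ I (g ∘ ab) (g′ ∘ ab))) refl)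
  (trans (cong (_+ (g merged + g′ merged)) (+-interchange (∑< I (g ∘ ba)) (∑< I (g′ ∘ ba)) (∑< I (g ∘ ab)) (∑< I (g′ ∘ ab))))
         (+-interchange (∑< I (g ∘ ba) + ∑< I (g ∘ ab)) (∑< I (g′ ∘ ba) + ∑< I (g′ ∘ ab)) (g merged) (g′ merged)))

*-distribˡ-∑slot : ∀ I c (g : Slot → ℕ) → c * ∑slot I g ≡ ∑slot I (λ s → c * g s)
*-distribˡ-∑slot I c g = trans (*-distribˡ-+ c _ (g merged))
  (cong (_+ c * g merged) (trans (*-distribˡ-+ c _ _) (cong₂ _+_ (*-distribˡ-∑< I c (g ∘ ba)) (*-distribˡ-∑< I c (g ∘ ab)))))

Coefficients : Set
Coefficients = Slot → ℕ → ℕ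

shiftᶜ : Coefficients → Coefficients
shiftᶜ c s k = c s (suc k)

-- The closed-form coefficients, with binom(n+1, i+k-m+1) written as suc n C[ suc (i + k) ⊖ m ].
shuffleCoeff : ℕ → ℕ → Coefficients
shuffleCoeff m n (ba i) k = (k C n) * suc n C[ suc (i + k) ⊖ m ]
shuffleCoeff m n (ab i) k = (k C m) * suc m C[ suc (i + k) ⊖ n ]
shuffleCoeff m n merged k = (k C n) * n C[ k ⊖ m ]

shuffleCoeff-pascal : ∀ m n s k → shuffleCoeff (suc m) (suc n) s (suc k) ≡
                      shuffleCoeff m (suc n) s k + shuffleCoeff (suc m) n s k + shuffleCoeff m n s k
shuffleCoeff-pascal m n (ba i) k
  rewrite +-suc i k | sym (nCk+nC[k+1]≡[n+1]C[k+1] k n) | [1+p]C[u⊖v]≡pC[u⊖1+v]+pC[u⊖v] (suc n) (suc (i + k)) m =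
  solve 4 (λ A B X Y → (A :+ B) :* (X :+ Y) := B :* (X :+ Y) :+ A :* X :+ A :* Y) refl
    (k C n) (k C suc n) (suc n C[ i + k ⊖ m ]) (suc n C[ suc (i + k) ⊖ m ])
shuffleCoeff-pascal m n (ab i) k
  rewrite +-suc i k | sym (nCk+nC[k+1]≡[n+1]C[k+1] k m) | [1+p]C[u⊖v]≡pC[u⊖1+v]+pC[u⊖v] (suc m) (suc (i + k)) n =
  solve 4 (λ A B X Y → (A :+ B) :* (X :+ Y) := A :* X :+ B :* (X :+ Y) :+ A :* Y) refl
    (k C m) (k C suc m) (suc m C[ i + k ⊖ n ]) (suc m C[ suc (i + k) ⊖ n ])
shuffleCoeff-pascal m n merged k
  rewrite sym (nCk+nC[k+1]≡[n+1]C[k+1] k n) | [1+p]C[u⊖v]≡pC[u⊖1+v]+pC[u⊖v] n k m =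
  solve 4 (λ A B X Y → (A :+ B) :* (X :+ Y) := B :* (X :+ Y) :+ A :* X :+ A :* Y) refl
    (k C n) (k C suc n) (n C[ k ⊖ suc m ]) (n C[ k ⊖ m ])

[1+k]C[1+n]*[2+n]C[2+i+k]≡kCn*[1+n]C[1+i+k] : ∀ i k n →
  (suc k C suc n) * (suc (suc n) C suc (suc (i + k))) ≡ (k C n) * (suc n C suc (i + k))
[1+k]C[1+n]*[2+n]C[2+i+k]≡kCn*[1+n]C[1+i+k] i k n =
  [1+k]C[1+n]*[1+p]C[1+j]≡kCn*pCj k n (suc n) (suc (i + k))
    (s≤s (subst₂ _≤_ (+-comm k n) (sym (+-assoc i k n)) (m≤n+m (k + n) i)))

shuffleCoeff-0-suc : ∀ n s k → shuffleCoeff 0 (suc n) s (suc k) ≡ shuffleCoeff 0 n s k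
shuffleCoeff-0-suc n (ba i) k rewrite +-suc i k = [1+k]C[1+n]*[2+n]C[2+i+k]≡kCn*[1+n]C[1+i+k] i k n
shuffleCoeff-0-suc n (ab i) k rewrite +-suc i k = refl
shuffleCoeff-0-suc n merged k = [1+k]C[1+n]*[1+p]C[1+j]≡kCn*pCj k n n k (≤-reflexive (+-comm n k))

shuffleCoeff-suc-0 : ∀ m s k → shuffleCoeff (suc m) 0 s (suc k) ≡ shuffleCoeff m 0 s k
shuffleCoeff-suc-0 m (ba i) k rewrite +-suc i k = refl
shuffleCoeff-suc-0 m (ab i) k rewrite +-suc i k = [1+k]C[1+n]*[2+n]C[2+i+k]≡kCn*[1+n]C[1+i+k] i k m
shuffleCoeff-suc-0 m merged k = refl

shuffleCoeff-0-0 : ∀ s k → shuffleCoeff 0 0 s (suc k) ≡ 0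
shuffleCoeff-0-0 (ba i) k rewrite +-suc i k = refl
shuffleCoeff-0-0 (ab i) k rewrite +-suc i k = refl
shuffleCoeff-0-0 merged k = refl

module _ (a b : ℕ) where

  word : Slot → ℕ → Word
  word (ba i) k = zeros k ++ b ∷ zeros i ++ a ∷ []
  word (ab i) k = zeros k ++ a ∷ zeros i ++ b ∷ []
  word merged k = zeros k ++ a + b ∷ []

  word-suc : ∀ s k → word s (suc k) ≡ 0 ∷ word s k
  word-suc (ba i) k = refl
  word-suc (ab i) k = refl
  word-suc merged k = refl

  boxCoeff : ℕ → ℕ → Coefficients → Word → ℕ
  boxCoeff I K c w = ∑slot I (λ s → ∑< K (λ k → c s k * δ (word s k) w))

  boxCoeff-cong : ∀ I K {c c′ : Coefficients} w → (∀ s k → c s k ≡ c′ s k) → boxCoeff I K c w ≡ boxCoeff I K c′ w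
  boxCoeff-cong I K w eq = ∑slot-cong I (λ s → ∑<-cong K (λ k → cong (_* δ (word s k) w) (eq s k)))

  boxCoeff-vanish : ∀ I K {c : Coefficients} w → (∀ s k → c s k ≡ 0) → boxCoeff I K c w ≡ 0
  boxCoeff-vanish I K w eq = ∑slot-vanish I (λ s → ∑<-vanish K (λ k _ → cong (_* δ (word s k) w) (eq s k)))

  boxCoeff-+ : ∀ I K (c c′ : Coefficients) w → boxCoeff I K (λ s k → c s k + c′ s k) w ≡ boxCoeff I K c w + boxCoeff I K c′ w
  boxCoeff-+ I K c c′ w = trans
    (∑slot-cong I (λ s → trans (∑<-cong K (λ k → *-distribʳ-+ (δ (word s k) w) (c s k) (c′ s k)))
                               (∑<-distrib-+ K (λ k → c s k * δ (word s k) w) (λ k → c′ s k * δ (word s k) w))))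
    (∑slot-distrib-+ I (λ s → ∑< K (λ k → c s k * δ (word s k) w)) (λ s → ∑< K (λ k → c′ s k * δ (word s k) w)))

  baseLayer : ℕ → Coefficients → Word → ℕ
  baseLayer I c w = ∑slot I (λ s → c s 0 * δ (word s 0) w)

  boxCoeff-suc : ∀ I K c w → boxCoeff I (suc K) c w ≡ baseLayer I c w + headδ 0 w * boxCoeff I K (shiftᶜ c) (drop 1 w)
  boxCoeff-suc I K c w = begin
    boxCoeff I (suc K) c w                                   ≡⟨ ∑slot-cong I (λ s → cong (col s +_) (∑<-cong K (shifted s))) ⟩
    ∑slot I (λ s → col s + ∑< K (λ k → h * rest s k))     ≡⟨ ∑slot-distrib-+ I col (λ s → ∑< K (λ k → h * rest s k)) ⟩
    baseLayer I c w + ∑slot I (λ s → ∑< K (λ k → h * rest s k))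
      ≡⟨ cong (baseLayer I c w +_) (∑slot-cong I (λ s → *-distribˡ-∑< K h (rest s))) ⟨
    baseLayer I c w + ∑slot I (λ s → h * ∑< K (rest s))      ≡⟨ cong (baseLayer I c w +_) (*-distribˡ-∑slot I h (λ s → ∑< K (rest s))) ⟨
    baseLayer I c w + h * boxCoeff I K (shiftᶜ c) w′            ∎
    where
    open ≡-Reasoning
    h = headδ 0 w
    w′ = drop 1 w
    col : Slot → ℕ
    col s = c s 0 * δ (word s 0) w
    rest : Slot → ℕ → ℕ
    rest s k = c s (suc k) * δ (word s k) w′
    shifted : ∀ s k → c s (suc k) * δ (word s (suc k)) w ≡ h * rest s k
    shifted s k = begin
      c s (suc k) * δ (word s (suc k)) w          ≡⟨ cong (λ v → c s (suc k) * δ v w) (word-suc s k) ⟩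
      c s (suc k) * δ (0 ∷ word s k) w            ≡⟨ cong (c s (suc k) *_) (δ-∷ 0 (word s k) w) ⟩
      c s (suc k) * (h * δ (word s k) w′)         ≡⟨ x*[y*z]≡y*[x*z] (c s (suc k)) h _ ⟩
      h * rest s k                                ∎

  shuffle : ℕ → ℕ → LinComb
  shuffle m n = (zeros m ++ a ∷ []) ⋆ (zeros n ++ b ∷ [])

  coeff-shuffle-0-0 : ∀ w → coeff (shuffle 0 0) w ≡ δ (word (ba 0) 0) w + δ (word (ab 0) 0) w + δ (word merged 0) w
  coeff-shuffle-0-0 w = trans
    (coeff-++³ (1 · word (ab 0) 0) (1 · word (ba 0) 0) (1 · word merged 0) w
               (coeff-1· (word (ab 0) 0) w) (coeff-1· (word (ba 0) 0) w) (coeff-1· (word merged 0) w))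
    (cong (_+ δ (word merged 0) w) (+-comm (δ (word (ab 0) 0) w) _))

  coeff-shuffle-0-suc : ∀ n w → coeff (shuffle 0 (suc n)) w ≡
    δ (word (ab n) 0) w + δ (word (ab (suc n)) 0) w + headδ 0 w * coeff (shuffle 0 n) (drop 1 w)
  coeff-shuffle-0-suc n w = trans
    (coeff-++³ (1 · word (ab (suc n)) 0) (prepend 0 (shuffle 0 n)) (1 · (a + 0 ∷ zeros n ++ b ∷ [])) w
               (coeff-1· (word (ab (suc n)) 0) w) (coeff-prepend 0 (shuffle 0 n) w)
               (trans (cong (λ c → coeff (1 · (c ∷ zeros n ++ b ∷ [])) w) (+-identityʳ a)) (coeff-1· (word (ab n) 0) w)))
    (solve 3 (λ x p y → x :+ p :+ y := y :+ x :+ p) refl (δ (word (ab (suc n)) 0) w) _ (δ (word (ab n) 0) w))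

  coeff-shuffle-suc-0 : ∀ m w → coeff (shuffle (suc m) 0) w ≡
    δ (word (ba m) 0) w + δ (word (ba (suc m)) 0) w + headδ 0 w * coeff (shuffle m 0) (drop 1 w)
  coeff-shuffle-suc-0 m w = trans
    (coeff-++³ (prepend 0 (shuffle m 0)) (1 · word (ba (suc m)) 0) (prepend b ((zeros m ++ a ∷ []) ⋆ [])) w
               (coeff-prepend 0 (shuffle m 0) w) (coeff-1· (word (ba (suc m)) 0) w)
               (trans (cong (λ l → coeff (prepend b l) w) (⋆-identityʳ (zeros m ++ a ∷ []))) (coeff-1· (word (ba m) 0) w)))
    (solve 3 (λ p x y → p :+ x :+ y := y :+ x :+ p) refl _ (δ (word (ba (suc m)) 0) w) (δ (word (ba m) 0) w))

  coeff-shuffle-suc-suc : ∀ m n w → coeff (shuffle (suc m) (suc n)) w ≡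
    headδ 0 w * (coeff (shuffle m (suc n)) (drop 1 w) + coeff (shuffle (suc m) n) (drop 1 w) + coeff (shuffle m n) (drop 1 w))
  coeff-shuffle-suc-suc m n w = trans
    (coeff-++³ (prepend 0 (shuffle m (suc n))) (prepend 0 (shuffle (suc m) n)) (prepend 0 (shuffle m n)) w
               (coeff-prepend 0 (shuffle m (suc n)) w) (coeff-prepend 0 (shuffle (suc m) n) w) (coeff-prepend 0 (shuffle m n) w))
    (solve 4 (λ h x y z → h :* x :+ h :* y :+ h :* z := h :* (x :+ y :+ z)) refl (headδ 0 w) _ _ _)

  baseLayer-0-0 : ∀ I w → 1 ≤ I →
    baseLayer I (shuffleCoeff 0 0) w ≡ δ (word (ba 0) 0) w + δ (word (ab 0) 0) w + δ (word merged 0) w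
  baseLayer-0-0 I w 1≤I =
    cong₂ _+_ (cong₂ _+_ (pick ba (λ i → bottom i)) (pick ab (λ i → bottom i))) (*-identityˡ (δ (word merged 0) w))
    where
    bottom : ∀ i → 1 * (1 C suc (i + 0)) ≡ 1 C suc i
    bottom i = trans (*-identityˡ _) (cong (λ j → 1 C suc j) (+-identityʳ i))
    pick : ∀ shape → (∀ i → shuffleCoeff 0 0 (shape i) 0 ≡ 1 C suc i) →
           ∑< I (λ i → shuffleCoeff 0 0 (shape i) 0 * δ (word (shape i) 0) w) ≡ δ (word (shape 0) 0) w
    pick shape eq = trans (∑<-cong I (λ i → cong (_* δ (word (shape i) 0) w) (eq i)))
                          (∑<-pick-first I (λ i → δ (word (shape i) 0) w) 1≤I)

  baseLayer-0-suc : ∀ I n w → 2 + n ≤ I →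
    baseLayer I (shuffleCoeff 0 (suc n)) w ≡ δ (word (ab n) 0) w + δ (word (ab (suc n)) 0) w
  baseLayer-0-suc I n w 2+n≤I = begin
    ∑< I (λ _ → 0) + ∑< I (λ i → shuffleCoeff 0 (suc n) (ab i) 0 * h i) + 0
      ≡⟨ trans (+-identityʳ _) (cong (_+ ∑< I (λ i → shuffleCoeff 0 (suc n) (ab i) 0 * h i)) (∑<-vanish I (λ _ _ → refl))) ⟩
    ∑< I (λ i → shuffleCoeff 0 (suc n) (ab i) 0 * h i)
      ≡⟨ ∑<-cong I (λ i → cong (_* h i) (trans (*-identityˡ _) (cong (1 C[_⊖ n ]) (+-identityʳ i)))) ⟩
    ∑< I (λ i → 1 C[ i ⊖ n ] * h i)
      ≡⟨ ∑<-pick-two n I h 2+n≤I ⟩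
    h n + h (suc n)
      ∎
    where
    open ≡-Reasoning
    h : ℕ → ℕ
    h i = δ (word (ab i) 0) w

  baseLayer-suc-0 : ∀ I m w → 2 + m ≤ I →
    baseLayer I (shuffleCoeff (suc m) 0) w ≡ δ (word (ba m) 0) w + δ (word (ba (suc m)) 0) w
  baseLayer-suc-0 I m w 2+m≤I = begin
    ∑< I (λ i → shuffleCoeff (suc m) 0 (ba i) 0 * h i) + ∑< I (λ _ → 0) + 0
      ≡⟨ trans (+-identityʳ _) (trans (cong (∑< I (λ i → shuffleCoeff (suc m) 0 (ba i) 0 * h i) +_) (∑<-vanish I (λ _ _ → refl)))
                                      (+-identityʳ _)) ⟩
    ∑< I (λ i → shuffleCoeff (suc m) 0 (ba i) 0 * h i)
      ≡⟨ ∑<-cong I (λ i → cong (_* h i) (trans (*-identityˡ _) (cong (1 C[_⊖ m ]) (+-identityʳ i)))) ⟩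
    ∑< I (λ i → 1 C[ i ⊖ m ] * h i)
      ≡⟨ ∑<-pick-two m I h 2+m≤I ⟩
    h m + h (suc m)
      ∎
    where
    open ≡-Reasoning
    h : ℕ → ℕ
    h i = δ (word (ba i) 0) w

  baseLayer-suc-suc : ∀ I m n w → baseLayer I (shuffleCoeff (suc m) (suc n)) w ≡ 0
  baseLayer-suc-suc I m n w =
    ∑slot-vanish I {λ s → shuffleCoeff (suc m) (suc n) s 0 * δ (word s 0) w} λ { (ba i) → refl ; (ab i) → refl ; merged → refl }

  coeff-shuffle : ∀ m n I K → m + n < I → m + n < K → ∀ w → coeff (shuffle m n) w ≡ boxCoeff I K (shuffleCoeff m n) w
  coeff-shuffle zero zero I (suc K) 0<I _ w = begin
    coeff (shuffle 0 0) w                                           ≡⟨ coeff-shuffle-0-0 w ⟩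
    δ (word (ba 0) 0) w + δ (word (ab 0) 0) w + δ (word merged 0) w  ≡⟨ baseLayer-0-0 I w 0<I ⟨
    baseLayer I c w                                                    ≡⟨ +-identityʳ _ ⟨
    baseLayer I c w + 0
      ≡⟨ cong (baseLayer I c w +_) (trans (cong (headδ 0 w *_) (boxCoeff-vanish I K (drop 1 w) shuffleCoeff-0-0)) (*-zeroʳ (headδ 0 w))) ⟨
    baseLayer I c w + headδ 0 w * boxCoeff I K (shiftᶜ c) (drop 1 w)      ≡⟨ boxCoeff-suc I K c w ⟨
    boxCoeff I (suc K) c w                                             ∎
    where
    open ≡-Reasoning
    c = shuffleCoeff 0 0
  coeff-shuffle zero (suc n) I (suc K) 1+n<I (s≤s n<K) w = begin
    coeff (shuffle 0 (suc n)) w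
      ≡⟨ coeff-shuffle-0-suc n w ⟩
    δ (word (ab n) 0) w + δ (word (ab (suc n)) 0) w + headδ 0 w * coeff (shuffle 0 n) (drop 1 w)
      ≡⟨ cong₂ _+_ (sym (baseLayer-0-suc I n w 1+n<I))
                   (cong (headδ 0 w *_) (coeff-shuffle 0 n I K (<-trans (n<1+n n) 1+n<I) n<K (drop 1 w))) ⟩
    baseLayer I c w + headδ 0 w * boxCoeff I K (shuffleCoeff 0 n) (drop 1 w)
      ≡⟨ cong (λ t → baseLayer I c w + headδ 0 w * t) (boxCoeff-cong I K (drop 1 w) (shuffleCoeff-0-suc n)) ⟨
    baseLayer I c w + headδ 0 w * boxCoeff I K (shiftᶜ c) (drop 1 w)
      ≡⟨ boxCoeff-suc I K c w ⟨
    boxCoeff I (suc K) c w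
      ∎
    where
    open ≡-Reasoning
    c = shuffleCoeff 0 (suc n)
  coeff-shuffle (suc m) zero I (suc K) 1+m<I (s≤s m<K) w = begin
    coeff (shuffle (suc m) 0) w
      ≡⟨ coeff-shuffle-suc-0 m w ⟩
    δ (word (ba m) 0) w + δ (word (ba (suc m)) 0) w + headδ 0 w * coeff (shuffle m 0) (drop 1 w)
      ≡⟨ cong₂ _+_ (sym (baseLayer-suc-0 I m w (subst (λ t → 2 + t ≤ I) (+-identityʳ m) 1+m<I)))
                   (cong (headδ 0 w *_) (coeff-shuffle m 0 I K (<-trans (n<1+n _) 1+m<I) m<K (drop 1 w))) ⟩
    baseLayer I c w + headδ 0 w * boxCoeff I K (shuffleCoeff m 0) (drop 1 w)
      ≡⟨ cong (λ t → baseLayer I c w + headδ 0 w * t) (boxCoeff-cong I K (drop 1 w) (shuffleCoeff-suc-0 m)) ⟨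
    baseLayer I c w + headδ 0 w * boxCoeff I K (shiftᶜ c) (drop 1 w)
      ≡⟨ boxCoeff-suc I K c w ⟨
    boxCoeff I (suc K) c w
      ∎
    where
    open ≡-Reasoning
    c = shuffleCoeff (suc m) 0
  coeff-shuffle (suc m) (suc n) I (suc K) 2+m+n<I (s≤s 1+m+n<K) w = begin
    coeff (shuffle (suc m) (suc n)) w
      ≡⟨ coeff-shuffle-suc-suc m n w ⟩
    h * (coeff (shuffle m (suc n)) w′ + coeff (shuffle (suc m) n) w′ + coeff (shuffle m n) w′)
      ≡⟨ cong (h *_) (cong₂ _+_ (cong₂ _+_ (coeff-shuffle m (suc n) I K 1+m+n<I 1+m+n<K w′)
                                           (coeff-shuffle (suc m) n I K (swap 1+m+n<I) (swap 1+m+n<K) w′))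
                                (coeff-shuffle m n I K (<-trans (n<1+n _) (swap 1+m+n<I)) (<-trans (n<1+n _) (swap 1+m+n<K)) w′)) ⟩
    h * (boxCoeff I K (shuffleCoeff m (suc n)) w′ + boxCoeff I K (shuffleCoeff (suc m) n) w′ + boxCoeff I K (shuffleCoeff m n) w′)
      ≡⟨ cong (h *_) (trans (boxCoeff-+ I K (λ s k → shuffleCoeff m (suc n) s k + shuffleCoeff (suc m) n s k) (shuffleCoeff m n) w′)
                            (cong (_+ boxCoeff I K (shuffleCoeff m n) w′)
                                  (boxCoeff-+ I K (shuffleCoeff m (suc n)) (shuffleCoeff (suc m) n) w′))) ⟨
    h * boxCoeff I K (λ s k → shuffleCoeff m (suc n) s k + shuffleCoeff (suc m) n s k + shuffleCoeff m n s k) w′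
      ≡⟨ cong (h *_) (boxCoeff-cong I K w′ (shuffleCoeff-pascal m n)) ⟨
    h * boxCoeff I K (shiftᶜ c) w′
      ≡⟨ cong (_+ h * boxCoeff I K (shiftᶜ c) w′) (baseLayer-suc-suc I m n w) ⟨
    baseLayer I c w + h * boxCoeff I K (shiftᶜ c) w′
      ≡⟨ boxCoeff-suc I K c w ⟨
    boxCoeff I (suc K) c w
      ∎
    where
    open ≡-Reasoning
    c = shuffleCoeff (suc m) (suc n)
    h = headδ 0 w
    w′ = drop 1 w
    swap : ∀ {L} → m + suc n < L → suc m + n < L
    swap {L} = subst (_< L) (+-suc m n)
    1+m+n<I : m + suc n < I
    1+m+n<I = <-trans (n<1+n _) 2+m+n<I

open import Data.Integer using (+_) renaming (_+_ to _+ℤ_; _-_ to _-ℤ_)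
import Data.Integer as ℤ
import Data.Integer.Properties as ℤ

binom-⊖ : ∀ p u v → binom p (u ℤ.⊖ v) ≡ p C[ u ⊖ v ]
binom-⊖ p u       zero    = cong (binom p) (ℤ.⊖-≥ {u} z≤n)
binom-⊖ p zero    (suc v) = cong (binom p) (ℤ.⊖-< (s≤s (z≤n {v})))
binom-⊖ p (suc u) (suc v) = trans (cong (binom p) (ℤ.[1+m]⊖[1+n]≡m⊖n u v)) (binom-⊖ p u v)

binom-[u-v] : ∀ p u v → binom p (+ u -ℤ + v) ≡ p C[ u ⊖ v ]
binom-[u-v] p u v = trans (cong (binom p) (ℤ.[+m]-[+n]≡m⊖n u v)) (binom-⊖ p u v)

binom-[u-v+1] : ∀ p u v → binom p (+ u -ℤ + v +ℤ + 1) ≡ p C[ suc u ⊖ v ]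
binom-[u-v+1] p u v = begin
  binom p (+ u -ℤ + v +ℤ + 1)   ≡⟨ cong (λ z → binom p (z +ℤ + 1)) (ℤ.[+m]-[+n]≡m⊖n u v) ⟩
  binom p (u ℤ.⊖ v +ℤ + 1)      ≡⟨ cong (binom p) (ℤ.distribˡ-⊖-+-pos 1 u v) ⟩
  binom p (u + 1 ℤ.⊖ v)         ≡⟨ cong (λ z → binom p (z ℤ.⊖ v)) (+-comm u 1) ⟩
  binom p (suc u ℤ.⊖ v)         ≡⟨ binom-⊖ p (suc u) v ⟩
  p C[ suc u ⊖ v ]              ∎
  where open ≡-Reasoning

module _ (a b m n : ℕ) where

  baTerms abTerms mergedTerms : LinComb
  baTerms = Σ[ 0 to m ] (λ i → Σ[ n to m + n ∸ i ] (λ k →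
    ((k C n) * binom (n + 1) (+ (i + k) -ℤ + m +ℤ + 1)) · (zeros k ++ b ∷ zeros i ++ a ∷ [])))
  abTerms = Σ[ 0 to n ] (λ i → Σ[ m to m + n ∸ i ] (λ k →
    ((k C m) * binom (m + 1) (+ (i + k) -ℤ + n +ℤ + 1)) · (zeros k ++ a ∷ zeros i ++ b ∷ [])))
  mergedTerms = Σ[ n to m + n ] (λ k → ((k C n) * binom n (+ k -ℤ + m)) · (zeros k ++ a + b ∷ []))

  coeff-baTerms : ∀ w → coeff baTerms w ≡
    ∑< (suc (m + n)) (λ i → ∑< (suc (m + n)) (λ k → shuffleCoeff m n (ba i) k * δ (word a b (ba i) k) w))
  coeff-baTerms w = coeff-Σ-triangle m n (m + n) (λ i k → (k C n) * binom (n + 1) (+ (i + k) -ℤ + m +ℤ + 1))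
    (λ i k → shuffleCoeff m n (ba i) k) (λ i k → word a b (ba i) k) w refl
    (λ i k → cong ((k C n) *_) (trans (binom-[u-v+1] (n + 1) (i + k) m) (cong (_C[ suc (i + k) ⊖ m ]) (+-comm n 1))))
    (λ i k → k<n⇒kCn*x≡0 _)
    (λ i k m+n<i+k → p+v<u⇒x*pC[u⊖v]≡0 (k C n) (suc n) (suc (i + k)) m (s≤s (subst (_< i + k) (+-comm m n) m+n<i+k)))

  coeff-abTerms : ∀ w → coeff abTerms w ≡
    ∑< (suc (m + n)) (λ i → ∑< (suc (m + n)) (λ k → shuffleCoeff m n (ab i) k * δ (word a b (ab i) k) w))
  coeff-abTerms w = coeff-Σ-triangle n m (m + n) (λ i k → (k C m) * binom (m + 1) (+ (i + k) -ℤ + n +ℤ + 1))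
    (λ i k → shuffleCoeff m n (ab i) k) (λ i k → word a b (ab i) k) w (+-comm n m)
    (λ i k → cong ((k C m) *_) (trans (binom-[u-v+1] (m + 1) (i + k) n) (cong (_C[ suc (i + k) ⊖ n ]) (+-comm m 1))))
    (λ i k → k<n⇒kCn*x≡0 _)
    (λ i k m+n<i+k → p+v<u⇒x*pC[u⊖v]≡0 (k C m) (suc m) (suc (i + k)) n (s≤s m+n<i+k))

  coeff-mergedTerms : ∀ w → coeff mergedTerms w ≡
    ∑< (suc (m + n)) (λ k → shuffleCoeff m n merged k * δ (word a b merged k) w)
  coeff-mergedTerms w = coeff-Σ-window n (m + n) (λ k → (k C n) * binom n (+ k -ℤ + m))
    (shuffleCoeff m n merged) (word a b merged) w (≤-trans (m≤n+m n m) (n≤1+n _))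
    (λ k → cong ((k C n) *_) (binom-[u-v] n k m))
    (λ k → k<n⇒kCn*x≡0 _)
    (λ k m+n<k → p+v<u⇒x*pC[u⊖v]≡0 (k C n) n k m (subst (_< k) (+-comm m n) m+n<k))

corollary5p4 : (a b m n : ℕ) →
    ((zeros m ++ a ∷ []) ⋆ (zeros n ++ b ∷ []))
      ≈ₗ
    (Σ[ 0 to m ] (λ i → Σ[ n to m + n ∸ i ] (λ k →
        ((k C n) * binom (n + 1) (+ (i + k) -ℤ + m +ℤ + 1))
          · (zeros k ++ b ∷ zeros i ++ a ∷ [])))
     ++ Σ[ 0 to n ] (λ i → Σ[ m to m + n ∸ i ] (λ k →
        ((k C m) * binom (m + 1) (+ (i + k) -ℤ + n +ℤ + 1))
          · (zeros k ++ a ∷ zeros i ++ b ∷ [])))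
     ++ Σ[ n to m + n ] (λ k →
        ((k C n) * binom n (+ k -ℤ + m)) · (zeros k ++ a + b ∷ [])))
corollary5p4 a b m n w =
  trans (coeff-shuffle a b m n (suc (m + n)) (suc (m + n)) ≤-refl ≤-refl w)
        (sym (coeff-++³ (baTerms a b m n) (abTerms a b m n) (mergedTerms a b m n) w
               (coeff-baTerms a b m n w) (coeff-abTerms a b m n w) (coeff-mergedTerms a b m n w)))
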